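{- Let $d$ be a positive integer and let $H$ be the $d\times d$ matrix with entries $$H(i,j)=2^{ -j}\binom{d-i-1}{d-j-1},\qquad 0\le i,j\le d-1,$$ where $\binom{n}{m}=0$ whenever $m>n$ or $m<0$. Then: (i) for every $0\le i\le d-1$, $$H(i,i)<H(i,i+1)<\cdots<H\!\left(i,\left\lfloor\tfrac{d+2i}{3}\right\rfloor-1\right)\le H\!\left(i,\left\lfloor\tfrac{d+2i}{3}\right\rfloor\right)>\cdots>H(i,d-1);$$ (ii) $H(i,j)=H(i+1,j)+2H(i+1,j+1)$ for all $0\le i,j\le d-2$.
   Context: The matrix $H$ is the matrix relating the face vector $\mathbf f$ and the short cubical $h$-vector $\mathbf h^{(sc)}$ of a cubical $d$-polytope via $\mathbf f=\mathbf h^{(sc)}\cdot H$ (row vectors). -}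

module Defs where

open import Data.Nat using (ℕ; suc; _∸_; _^_)
open import Data.Nat.Properties using (m^n≢0)
open import Data.Nat.Combinatorics using (_C_)
open import Data.Integer using (+_)
open import Data.Rational using (ℚ; _/_)

-- Only used for 0 ≤ i, j ≤ d-1, where the truncated subtractions are exact.
-- Data.Nat.Combinatorics._C_ returns 0 when the lower index exceeds the upper one.
H : ℕ → ℕ → ℕ → ℚ
H d i j = (+ ((d ∸ i ∸ 1) C (d ∸ j ∸ 1))) / (2 ^ j)
  where instance _ = m^n≢0 2 j

module Submission where

-- Row i of H consists of the numbers  C(n, k) / 2^j  with  n = d-i-1  and  k = d-j-1.
-- (ii) is Pascal's rule C(n+1,k+1) = C(n,k) + C(n,k+1) read through the
-- identity  (a + b)/2^j = b/2^j + 2 · a/2^(j+1).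
-- (i): two neighbours in a row are  C(n, m+1)/2^j  and  C(n, m)/2^(j+1), and by the
-- absorption identity  C(n, m+1)·(m+1) = C(n, m)·(n-m)  the second exceeds the first
-- exactly when  2(n-m) < m+1.  In terms of d, i, j this reads  3(j+1) < d + 2i,
-- so the row rises while 3(j+1) < d + 2i and falls once d + 2i < 3(j+1); the
-- peak position  ⌊(d+2i)/3⌋  is located with the bounds  3⌊S/3⌋ ≤ S < 3(⌊S/3⌋+1).

open import Defs
open import Data.Nat using (ℕ; suc; _+_; _*_; _∸_; _≤_; _<_)
open import Data.Nat.DivMod using (_/_)
open import Data.Product using (_×_)
open import Data.Rational using (ℚ) renaming (_<_ to _<ℚ_; _≤_ to _≤ℚ_; _>_ to _>ℚ_; _+_ to _+ℚ_; _*_ to _*ℚ_; 1ℚ to oneℚ)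
open import Relation.Binary.PropositionalEquality using (_≡_)

open import Data.Nat as ℕ using (zero; _^_; _!; NonZero; s≤s; z<s)
open import Data.Nat.Properties
open import Data.Nat.Combinatorics using (_C_; nCk≡n!/k![n-k]!; k![n∸k]!∣n!; [n-k]*[n-k-1]!≡[n-k]!; nCk+nC[k+1]≡[n+1]C[k+1])
import Data.Nat.DivMod as ℕDiv
import Data.Nat.Tactic.RingSolver as ℕSolver
open import Data.Integer as ℤ using (ℤ; +_)
import Data.Integer.Properties as ℤP
import Data.Integer.Tactic.RingSolver as ℤSolver
import Data.Rational as ℚ
import Data.Rational.Properties as ℚP
open import Data.Rational.Unnormalised as ℚᵘ using (ℚᵘ; mkℚᵘ; *<*; *≤*; *≡*) renaming (_≃_ to _≃ᵘ_)
import Data.Rational.Unnormalised.Properties as ℚᵘP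
open import Data.Product using (_,_; proj₁; proj₂; ∃)
open import Relation.Binary.PropositionalEquality using (refl; sym; trans; cong; cong₂; subst; subst₂; module ≡-Reasoning)

-- Fractions  (+ a) / m  of natural numbers.  Comparisons and sums are computed in
-- ℚᵘ, where a fraction is not normalised and so is just a numerator/denominator pair.

toℚᵘ-/ : ∀ z m .{{_ : NonZero m}} → ℚ.toℚᵘ (z ℚ./ m) ≃ᵘ z ℚᵘ./ m
toℚᵘ-/ z (suc e) = ℚP.toℚᵘ-fromℚᵘ (mkℚᵘ z e)

/-<-cross : ∀ a b m n .{{_ : NonZero m}} .{{_ : NonZero n}} →
  a * n < b * m → (+ a) ℚ./ m <ℚ (+ b) ℚ./ n
/-<-cross a b m@(suc _) n@(suc _) lt = ℚP.toℚᵘ-cancel-<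
  (ℚᵘP.<-respˡ-≃ (ℚᵘP.≃-sym (toℚᵘ-/ (+ a) m))
  (ℚᵘP.<-respʳ-≃ (ℚᵘP.≃-sym (toℚᵘ-/ (+ b) n))
  (*<* (subst₂ ℤ._<_ (ℤP.pos-* a n) (ℤP.pos-* b m) (ℤ.+<+ lt)))))

/-≤-cross : ∀ a b m n .{{_ : NonZero m}} .{{_ : NonZero n}} →
  a * n ≤ b * m → (+ a) ℚ./ m ≤ℚ (+ b) ℚ./ n
/-≤-cross a b m@(suc _) n@(suc _) le = ℚP.toℚᵘ-cancel-≤
  (ℚᵘP.≤-respˡ-≃ (ℚᵘP.≃-sym (toℚᵘ-/ (+ a) m))
  (ℚᵘP.≤-respʳ-≃ (ℚᵘP.≃-sym (toℚᵘ-/ (+ b) n))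
  (*≤* (subst₂ ℤ._≤_ (ℤP.pos-* a n) (ℤP.pos-* b m) (ℤ.+≤+ le)))))

/-+-halves : ∀ a b m .{{_ : NonZero m}} →
  (+ (a + b)) ℚ./ m ≡ (+ b) ℚ./ m +ℚ (oneℚ +ℚ oneℚ) *ℚ ℚ._/_ (+ a) (2 * m) {{m*n≢0 2 m}}
/-+-halves a b m@(suc e) = ℚP.toℚᵘ-injective (begin
  ℚ.toℚᵘ ((+ (a + b)) ℚ./ m)                      ≈⟨ toℚᵘ-/ (+ (a + b)) m ⟩
  (+ (a + b)) ℚᵘ./ m                              ≈⟨ split ⟩
  (+ b) ℚᵘ./ m ℚᵘ.+ two ℚᵘ.* ((+ a) ℚᵘ./ (2 * m))
    ≈⟨ ℚᵘP.≃-sym (ℚᵘP.+-cong (toℚᵘ-/ (+ b) m) (ℚᵘP.*-congˡ {two} (toℚᵘ-/ (+ a) (2 * m)))) ⟩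
  ℚ.toℚᵘ ((+ b) ℚ./ m) ℚᵘ.+ two ℚᵘ.* ℚ.toℚᵘ half
    ≈⟨ ℚᵘP.+-congʳ (ℚ.toℚᵘ ((+ b) ℚ./ m)) (ℚᵘP.≃-sym (ℚP.toℚᵘ-homo-* (oneℚ +ℚ oneℚ) half)) ⟩
  ℚ.toℚᵘ ((+ b) ℚ./ m) ℚᵘ.+ ℚ.toℚᵘ ((oneℚ +ℚ oneℚ) *ℚ half)
    ≈⟨ ℚᵘP.≃-sym (ℚP.toℚᵘ-homo-+ ((+ b) ℚ./ m) ((oneℚ +ℚ oneℚ) *ℚ half)) ⟩
  ℚ.toℚᵘ ((+ b) ℚ./ m +ℚ (oneℚ +ℚ oneℚ) *ℚ half) ∎)
  where
  open ℚᵘP.≃-Reasoning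
  two : ℚᵘ
  two = ℚ.toℚᵘ (oneℚ +ℚ oneℚ)
  half : ℚ
  half = (+ a) ℚ./ (2 * m)
  cross : ∀ (A B M : ℤ) →
    (A ℤ.+ B) ℤ.* (M ℤ.* (+ 2 ℤ.* M)) ≡ (B ℤ.* (+ 2 ℤ.* M) ℤ.+ (+ 2 ℤ.* A) ℤ.* M) ℤ.* M
  cross = ℤSolver.solve-∀
  ↧-last : ℚᵘ.↧ (two ℚᵘ.* ((+ a) ℚᵘ./ (2 * m))) ≡ + 2 ℤ.* + m
  ↧-last = trans (cong +_ (*-identityˡ (2 * m))) (ℤP.pos-* 2 m)
  split : (+ (a + b)) ℚᵘ./ m ≃ᵘ (+ b) ℚᵘ./ m ℚᵘ.+ two ℚᵘ.* ((+ a) ℚᵘ./ (2 * m))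
  split = *≡* (subst (λ F → (+ a ℤ.+ + b) ℤ.* (+ m ℤ.* F) ≡ (+ b ℤ.* F ℤ.+ (+ 2 ℤ.* + a) ℤ.* + m) ℤ.* + m)
    (sym ↧-last) (cross (+ a) (+ b) (+ m)))

dyadic : ℕ → ℕ → ℚ
dyadic a j = (+ a) ℚ./ (2 ^ j)
  where instance _ = m^n≢0 2 j

-- Cross-multiplying a/2^j against b/2^(j+1) moves the extra factor 2 onto a.
double-cross : ∀ a j → a * 2 ^ suc j ≡ (2 * a) * 2 ^ j
double-cross a j = e a (2 ^ j)
  where
  e : ∀ a p → a * (2 * p) ≡ (2 * a) * p
  e = ℕSolver.solve-∀

dyadic-< : ∀ {a b} j → 2 * a < b → dyadic a j <ℚ dyadic b (suc j)
dyadic-< {a} {b} j lt = /-<-cross a b (2 ^ j) (2 ^ suc j) {{m^n≢0 2 j}} {{m^n≢0 2 (suc j)}}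
  (subst (_< b * 2 ^ j) (sym (double-cross a j)) (*-monoˡ-< (2 ^ j) {{m^n≢0 2 j}} lt))

dyadic-≤ : ∀ {a b} j → 2 * a ≤ b → dyadic a j ≤ℚ dyadic b (suc j)
dyadic-≤ {a} {b} j le = /-≤-cross a b (2 ^ j) (2 ^ suc j) {{m^n≢0 2 j}} {{m^n≢0 2 (suc j)}}
  (subst (_≤ b * 2 ^ j) (sym (double-cross a j)) (*-monoˡ-≤ (2 ^ j) le))

dyadic-> : ∀ {a b} j → b < 2 * a → dyadic b (suc j) <ℚ dyadic a j
dyadic-> {a} {b} j lt = /-<-cross b a (2 ^ suc j) (2 ^ j) {{m^n≢0 2 (suc j)}} {{m^n≢0 2 j}}
  (subst (b * 2 ^ j <_) (sym (double-cross a j)) (*-monoˡ-< (2 ^ j) {{m^n≢0 2 j}} lt))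

dyadic-+ : ∀ a b j → dyadic (a + b) j ≡ dyadic b j +ℚ (oneℚ +ℚ oneℚ) *ℚ dyadic a (suc j)
dyadic-+ a b j = /-+-halves a b (2 ^ j) {{m^n≢0 2 j}}

C-factorial : ∀ {n k} → k ≤ n → (n C k) * (k ! * (n ∸ k) !) ≡ n !
C-factorial {n} {k} k≤n = trans (cong (_* (k ! * (n ∸ k) !)) (nCk≡n!/k![n-k]! k≤n))
  (ℕDiv.m/n*n≡m {{k !* (n ∸ k) !≢0}} (k![n∸k]!∣n! k≤n))

C-positive : ∀ {n k} → k ≤ n → 0 < n C k
C-positive {n} {k} k≤n = n≢0⇒n>0 λ C≡0 →
  ℕ.≢-nonZero⁻¹ (n !) {{n !≢0}} (trans (sym (C-factorial k≤n)) (cong (_* (k ! * (n ∸ k) !)) C≡0))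

-- Absorption: C(n, m+1) · (m+1) = C(n, m) · (n-m); both sides are n!/(m! (n-m-1)!).
C-absorption : ∀ {m n} → m < n → (n C suc m) * suc m ≡ (n C m) * (n ∸ m)
C-absorption {m} {n} m<n = *-cancelʳ-≡ _ _ (m ! * (n ∸ suc m) !) {{m !* (n ∸ suc m) !≢0}} (begin
  (n C suc m) * suc m * (m ! * (n ∸ suc m) !)       ≡⟨ shuffle (n C suc m) (suc m) (m !) ((n ∸ suc m) !) ⟩
  (n C suc m) * (suc m ! * (n ∸ suc m) !)           ≡⟨ C-factorial m<n ⟩
  n !                                               ≡⟨ sym (C-factorial (<⇒≤ m<n)) ⟩
  (n C m) * (m ! * (n ∸ m) !)                       ≡⟨ cong (λ f → (n C m) * (m ! * f)) (sym ([n-k]*[n-k-1]!≡[n-k]! m<n)) ⟩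
  (n C m) * (m ! * ((n ∸ m) * (n ∸ suc m) !))       ≡⟨ sym (shuffle′ (n C m) (n ∸ m) (m !) ((n ∸ suc m) !)) ⟩
  (n C m) * (n ∸ m) * (m ! * (n ∸ suc m) !)         ∎)
  where
  open ≡-Reasoning
  shuffle : ∀ c p x y → c * p * (x * y) ≡ c * (p * x * y)
  shuffle = ℕSolver.solve-∀
  shuffle′ : ∀ c p x y → c * p * (x * y) ≡ c * (x * (p * y))
  shuffle′ = ℕSolver.solve-∀

balance-< : ∀ {x y p q} → x * p ≡ y * q → 0 < y → q < p → x < y
balance-< {x} {y} {p} eq 0<y q<p = *-cancelʳ-< p x y
  (subst (_< y * p) (sym eq) (*-monoʳ-< y {{ℕ.>-nonZero 0<y}} q<p))

balance-≤ : ∀ {x y p q} → x * suc p ≡ y * q → q ≤ suc p → x ≤ y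
balance-≤ {x} {y} {p} eq q≤p = *-cancelʳ-≤ x y (suc p)
  (subst (_≤ y * suc p) (sym eq) (*-monoʳ-≤ y q≤p))

balance-> : ∀ {x y p q} → x * p ≡ y * q → 0 < y → p < q → y < x
balance-> {x} {y} {p} eq 0<y p<q = *-cancelʳ-< p y x
  (subst (y * p <_) (sym eq) (*-monoʳ-< y {{ℕ.>-nonZero 0<y}} p<q))

doubled-absorption : ∀ {m n} → m < n → (2 * (n C suc m)) * suc m ≡ (n C m) * (2 * (n ∸ m))
doubled-absorption {m} {n} m<n = begin
  (2 * (n C suc m)) * suc m   ≡⟨ *-assoc 2 (n C suc m) (suc m) ⟩
  2 * ((n C suc m) * suc m)   ≡⟨ cong (2 *_) (C-absorption m<n) ⟩
  2 * ((n C m) * (n ∸ m))     ≡⟨ swap (n C m) (n ∸ m) ⟩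
  (n C m) * (2 * (n ∸ m))     ∎
  where
  open ≡-Reasoning
  swap : ∀ c q → 2 * (c * q) ≡ c * (2 * q)
  swap = ℕSolver.solve-∀

step-< : ∀ {n m} j → m < n → 2 * (n ∸ m) < suc m → dyadic (n C suc m) j <ℚ dyadic (n C m) (suc j)
step-< {n} {m} j m<n lt = dyadic-< {n C suc m} {n C m} j (balance-< (doubled-absorption m<n) (C-positive (<⇒≤ m<n)) lt)

step-≤ : ∀ {n m} j → m < n → 2 * (n ∸ m) ≤ suc m → dyadic (n C suc m) j ≤ℚ dyadic (n C m) (suc j)
step-≤ {n} {m} j m<n le = dyadic-≤ {n C suc m} {n C m} j (balance-≤ (doubled-absorption m<n) le)

step-> : ∀ {n m} j → m < n → suc m < 2 * (n ∸ m) → dyadic (n C m) (suc j) <ℚ dyadic (n C suc m) j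
step-> {n} {m} j m<n lt = dyadic-> {n C suc m} {n C m} j (balance-> (doubled-absorption m<n) (C-positive (<⇒≤ m<n)) lt)

∸-offset : ∀ {d} a b → d ≡ a + suc b → d ∸ a ∸ 1 ≡ b
∸-offset a b refl = cong (_∸ 1) (m+n∸m≡n a (suc b))

-- Writing j = i + t and d = 2 + j + m, the entries H d i j and H d i (j+1) are the
-- terms at positions m+1 and m of the binomial row n = (t+1) + m, where n - m = t + 1,
-- and the comparison of 3(j+1) with d + 2i becomes the comparison of 2(t+1) with m+1.
module Row (i t m : ℕ) where
  j d n S X : ℕ
  j = i + t
  d = 2 + j + m
  n = suc t + m
  S = d + 2 * i
  X = 3 * i + t + 1

  row-index : d ∸ i ∸ 1 ≡ n
  row-index = ∸-offset i n (e i t m)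
    where
    e : ∀ i t m → 2 + (i + t) + m ≡ i + suc (suc t + m)
    e = ℕSolver.solve-∀

  H-left : H d i j ≡ dyadic (n C suc m) j
  H-left = cong₂ (λ a b → dyadic (a C b) j) row-index (∸-offset j (suc m) (e i t m))
    where
    e : ∀ i t m → 2 + (i + t) + m ≡ i + t + suc (suc m)
    e = ℕSolver.solve-∀

  H-right : H d i (suc j) ≡ dyadic (n C m) (suc j)
  H-right = cong₂ (λ a b → dyadic (a C b) (suc j)) row-index (∸-offset (suc j) m (e i t m))
    where
    e : ∀ i t m → 2 + (i + t) + m ≡ suc (i + t) + suc m
    e = ℕSolver.solve-∀

  m<n : m < n
  m<n = m<n+m m z<s

  n∸m : n ∸ m ≡ suc t
  n∸m = m+n∸n≡m (suc t) m

  S≡ : S ≡ X + suc m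
  S≡ = e i t m
    where
    e : ∀ i t m → 2 + (i + t) + m + 2 * i ≡ 3 * i + t + 1 + suc m
    e = ℕSolver.solve-∀

  3[j+1]≡ : 3 * suc j ≡ X + 2 * suc t
  3[j+1]≡ = e i t
    where
    e : ∀ i t → 3 * suc (i + t) ≡ 3 * i + t + 1 + 2 * suc t
    e = ℕSolver.solve-∀

  ascent : 3 * suc j < S → H d i j <ℚ H d i (suc j)
  ascent lt = subst₂ _<ℚ_ (sym H-left) (sym H-right) (step-< j m<n
    (subst (λ k → 2 * k < suc m) (sym n∸m) (+-cancelˡ-< X _ _ (subst₂ _<_ 3[j+1]≡ S≡ lt))))

  plateau : 3 * suc j ≤ S → H d i j ≤ℚ H d i (suc j)
  plateau le = subst₂ _≤ℚ_ (sym H-left) (sym H-right) (step-≤ j m<n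
    (subst (λ k → 2 * k ≤ suc m) (sym n∸m) (+-cancelˡ-≤ X _ _ (subst₂ _≤_ 3[j+1]≡ S≡ le))))

  descent : S < 3 * suc j → H d i (suc j) <ℚ H d i j
  descent lt = subst₂ _<ℚ_ (sym H-right) (sym H-left) (step-> j m<n
    (subst (λ k → suc m < 2 * k) (sym n∸m) (+-cancelˡ-< X _ _ (subst₂ _<_ S≡ 3[j+1]≡ lt))))

RowStep : ℕ → ℕ → ℕ → Set
RowStep d i j =
  (3 * suc j < d + 2 * i → H d i j <ℚ H d i (suc j))
  × (3 * suc j ≤ d + 2 * i → H d i j ≤ℚ H d i (suc j))
  × (d + 2 * i < 3 * suc j → H d i (suc j) <ℚ H d i j)

row-step : ∀ {d i j} → i ≤ j → 2 + j ≤ d → RowStep d i j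
row-step {d} {i} {j} i≤j 2+j≤d = reparametrise (m≤n⇒∃[o]m+o≡n i≤j) (m≤n⇒∃[o]m+o≡n 2+j≤d)
  where
  reparametrise : (∃ λ t → i + t ≡ j) → (∃ λ m → 2 + j + m ≡ d) → RowStep d i j
  reparametrise (t , refl) (m , refl) = Row.ascent i t m , Row.plateau i t m , Row.descent i t m

row-bound : ∀ {d i j} → i ≤ j → 3 * suc j ≤ d + 2 * i → 2 + j ≤ d
row-bound {d} {i} {j} i≤j le = +-cancelʳ-≤ (2 * j) (2 + j) d (begin
  2 + j + 2 * j         ≤⟨ n≤1+n (2 + j + 2 * j) ⟩
  suc (2 + j + 2 * j)   ≡⟨ e j ⟩
  3 * suc j             ≤⟨ le ⟩
  d + 2 * i             ≤⟨ +-monoʳ-≤ d (*-monoʳ-≤ 2 i≤j) ⟩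
  d + 2 * j             ∎)
  where
  open ≤-Reasoning
  e : ∀ j → suc (2 + j + 2 * j) ≡ 3 * suc j
  e = ℕSolver.solve-∀

⌊/3⌋-lower : ∀ S → 3 * (S / 3) ≤ S
⌊/3⌋-lower S = subst (_≤ S) (*-comm (S / 3) 3) (ℕDiv.m/n*n≤m S 3)

⌊/3⌋-upper : ∀ S → S < 3 * suc (S / 3)
⌊/3⌋-upper S = begin-strict
  S                    ≡⟨ ℕDiv.m≡m%n+[m/n]*n S 3 ⟩
  S ℕDiv.% 3 + S / 3 * 3  <⟨ +-monoˡ-< (S / 3 * 3) (ℕDiv.m%n<n S 3) ⟩
  suc (S / 3) * 3      ≡⟨ *-comm (suc (S / 3)) 3 ⟩
  3 * suc (S / 3)      ∎
  where open ≤-Reasoning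

≤∸1⇒2+≤ : ∀ {m M} → suc m ≤ M ∸ 1 → 2 + m ≤ M
≤∸1⇒2+≤ {M = suc M} le = s≤s le

row-rises : ∀ d i (j : ℕ) → i ≤ j → suc j ≤ (d + 2 * i) / 3 ∸ 1 → H d i j <ℚ H d i (suc j)
row-rises d i j i≤j j+1≤M-1 = proj₁ (row-step i≤j (row-bound i≤j (<⇒≤ below))) below
  where
  S = d + 2 * i
  below : 3 * suc j < S
  below = begin-strict
    3 * suc j          <⟨ *-monoʳ-< 3 (n<1+n (suc j)) ⟩
    3 * (2 + j)        ≤⟨ *-monoʳ-≤ 3 (≤∸1⇒2+≤ {M = S / 3} j+1≤M-1) ⟩
    3 * (S / 3)        ≤⟨ ⌊/3⌋-lower S ⟩
    S                  ∎
    where open ≤-Reasoning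

row-peak : ∀ d i → i < (d + 2 * i) / 3 → H d i ((d + 2 * i) / 3 ∸ 1) ≤ℚ H d i ((d + 2 * i) / 3)
row-peak d i = at ((d + 2 * i) / 3) (⌊/3⌋-lower (d + 2 * i))
  where
  at : ∀ M → 3 * M ≤ d + 2 * i → i < M → H d i (M ∸ 1) ≤ℚ H d i M
  at (suc k) 3M≤S (s≤s i≤k) = proj₁ (proj₂ (row-step i≤k (row-bound i≤k 3M≤S))) 3M≤S

-- Part (i), falling stretch: H(i,j) > H(i,j+1) for ⌊(d+2i)/3⌋ ≤ j and j + 1 ≤ d - 1.
-- Here i ≤ ⌊(d+2i)/3⌋ ≤ j because 3i < d + 2i < 3(⌊(d+2i)/3⌋ + 1).
row-falls : ∀ d i → i < d → (j : ℕ) → (d + 2 * i) / 3 ≤ j → suc j ≤ d ∸ 1 →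
  H d i j >ℚ H d i (suc j)
row-falls d i i<d j M≤j j+1≤d-1 = proj₂ (proj₂ (row-step i≤j (≤∸1⇒2+≤ j+1≤d-1))) above
  where
  S = d + 2 * i
  above : S < 3 * suc j
  above = <-≤-trans (⌊/3⌋-upper S) (*-monoʳ-≤ 3 (s≤s M≤j))
  i≤M : i ≤ S / 3
  i≤M = ℕ.s≤s⁻¹ (*-cancelˡ-< 3 i (suc (S / 3)) (<-trans (+-monoˡ-< (2 * i) i<d) (⌊/3⌋-upper S)))
  i≤j : i ≤ j
  i≤j = ≤-trans i≤M M≤j

∸-pred : ∀ d i → i + 2 ≤ d → d ∸ i ∸ 1 ≡ suc (d ∸ suc i ∸ 1)
∸-pred (suc (suc d)) zero    _         = refl
∸-pred (suc d)       (suc i) (s≤s le)  = ∸-pred d i le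
∸-pred (suc zero)    zero    (s≤s ())

pascal : ∀ d i j → i + 2 ≤ d → j + 2 ≤ d →
  H d i j ≡ H d (suc i) j +ℚ ((oneℚ +ℚ oneℚ) *ℚ H d (suc i) (suc j))
pascal d i j i+2≤d j+2≤d = begin
  H d i j                                              ≡⟨ cong₂ (λ a b → dyadic (a C b) j) (∸-pred d i i+2≤d) (∸-pred d j j+2≤d) ⟩
  dyadic (suc N C suc K) j                             ≡⟨ cong (λ c → dyadic c j) (sym (nCk+nC[k+1]≡[n+1]C[k+1] N K)) ⟩
  dyadic (N C K + N C suc K) j                         ≡⟨ dyadic-+ (N C K) (N C suc K) j ⟩
  dyadic (N C suc K) j +ℚ two *ℚ dyadic (N C K) (suc j) ≡⟨ cong (λ b → dyadic (N C b) j +ℚ two *ℚ dyadic (N C K) (suc j)) (sym (∸-pred d j j+2≤d)) ⟩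
  H d (suc i) j +ℚ two *ℚ H d (suc i) (suc j)          ∎
  where
  open ≡-Reasoning
  two = oneℚ +ℚ oneℚ
  N = d ∸ suc i ∸ 1
  K = d ∸ suc j ∸ 1

lemma1 : (d : ℕ) → 1 ≤ d →
    ((i : ℕ) → i < d →
      ((j : ℕ) → i ≤ j → suc j ≤ ((d + 2 * i) / 3) ∸ 1 → H d i j <ℚ H d i (suc j))
      × (i < (d + 2 * i) / 3 → H d i (((d + 2 * i) / 3) ∸ 1) ≤ℚ H d i ((d + 2 * i) / 3))
      × ((j : ℕ) → (d + 2 * i) / 3 ≤ j → suc j ≤ d ∸ 1 → H d i j >ℚ H d i (suc j)))
    × ((i j : ℕ) → i + 2 ≤ d → j + 2 ≤ d →
      H d i j ≡ H d (suc i) j +ℚ ((oneℚ +ℚ oneℚ) *ℚ H d (suc i) (suc j)))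
lemma1 d _ = (λ i i<d → row-rises d i , row-peak d i , row-falls d i i<d) , pascal d
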